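{- If a meet-semilattice monoid $V$ satisfies the decomposition property, then $V$ is cancellative and equidivisible.
   Context: A meet-semilattice monoid is an ordered monoid $V$ (operation $\cdot$) whose order is a meet-semilattice and such that $(w\cdot u)\wedge(w\cdot v)=w\cdot(u\wedge v)$ and $(u\cdot w)\wedge(v\cdot w)=(u\wedge v)\cdot w$ for all $u,v,w$. Order $V\times V$ componentwise. A pair $(v_1,v_2)$ is above $v$ if $v_1\cdot v_2\ge v$; minimal above $v$ if it is above $v$ and no pair $(u_1,u_2)<(v_1,v_2)$ is above $v$; minimal if it is minimal above $v_1\cdot v_2$. The pair $(v_1,v_2)$ has the convexity property if for every pair $(u_1,u_2)$ minimal above $v:=v_1\cdot v_2$, either there is $u_2^1\in V$ with $v_1\le u_1\cdot u_2^1$, $u_1\le v_1$ and $u_2=u_2^1\cdot v_2$, or there is $u_1^2\in V$ with $v_2\le u_1^2\cdot u_2$, $u_2\le v_2$ and $u_1=v_1\cdot u_1^2$. A pair is summable if it is minimal and has the convexity property; $V$ has the decomposition property if every pair is summable. Cancellative: $w\cdot u=w\cdot v\Rightarrow u=v$ and $u\cdot w=v\cdot w\Rightarrow u=v$. Equidivisible: $u_1\cdot u_2=v_1\cdot v_2$ implies that there is $w$ with either ($u_1=v_1\cdot w$, $v_2=w\cdot u_2$) or ($v_1=u_1\cdot w$, $u_2=w\cdot v_2$). -}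

module Defs where

open import Level using (Level; suc; _⊔_)
open import Data.Product using (_×_; Σ; ∃; ∃-syntax; _,_)
open import Data.Sum using (_⊎_)
open import Relation.Binary.PropositionalEquality using (_≡_)
open import Relation.Binary.Structures using (IsPartialOrder)
open import Relation.Binary.Lattice.Structures using (IsMeetSemilattice)
open import Algebra.Structures using (IsMonoid)

record MeetSemilatticeMonoid (c ℓ : Level) : Set (suc (c ⊔ ℓ)) where
  infixl 7 _·_
  infix 4 _≤_
  infixr 6 _∧_
  field
    Carrier            : Set c
    _≤_                : Carrier → Carrier → Set ℓ
    _·_                : Carrier → Carrier → Carrier
    ε                  : Carrier
    _∧_                : Carrier → Carrier → Carrier
    isMonoid           : IsMonoid _≡_ _·_ ε
    isMeetSemilattice  : IsMeetSemilattice _≡_ _≤_ _∧_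
    ·-monoˡ            : ∀ {u v} w → u ≤ v → u · w ≤ v · w
    ·-monoʳ            : ∀ {u v} w → u ≤ v → w · u ≤ w · v
    ·-distribˡ-∧       : ∀ w u v → (w · u) ∧ (w · v) ≡ w · (u ∧ v)
    ·-distribʳ-∧       : ∀ w u v → (u · w) ∧ (v · w) ≡ (u ∧ v) · w

module _ {c ℓ : Level} (V : MeetSemilatticeMonoid c ℓ) where
  open MeetSemilatticeMonoid V

  _≤₂_ : Carrier × Carrier → Carrier × Carrier → Set ℓ
  (u₁ , u₂) ≤₂ (v₁ , v₂) = (u₁ ≤ v₁) × (u₂ ≤ v₂)

  Above : Carrier × Carrier → Carrier → Set ℓ
  Above (v₁ , v₂) v = v ≤ v₁ · v₂

  MinimalAbove : Carrier × Carrier → Carrier → Set (c ⊔ ℓ)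
  MinimalAbove p v = Above p v × (∀ q → q ≤₂ p → Above q v → q ≡ p)

  Minimal : Carrier × Carrier → Set (c ⊔ ℓ)
  Minimal (v₁ , v₂) = MinimalAbove (v₁ , v₂) (v₁ · v₂)

  ConvexityProperty : Carrier × Carrier → Set (c ⊔ ℓ)
  ConvexityProperty (v₁ , v₂) =
    ∀ u₁ u₂ → MinimalAbove (u₁ , u₂) (v₁ · v₂) →
      (∃[ u₂¹ ] ((v₁ ≤ u₁ · u₂¹) × (u₁ ≤ v₁) × (u₂ ≡ u₂¹ · v₂)))
      ⊎ (∃[ u₁² ] ((v₂ ≤ u₁² · u₂) × (u₂ ≤ v₂) × (u₁ ≡ v₁ · u₁²)))

  Summable : Carrier × Carrier → Set (c ⊔ ℓ)
  Summable p = Minimal p × ConvexityProperty p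

  DecompositionProperty : Set (c ⊔ ℓ)
  DecompositionProperty = ∀ v₁ v₂ → Summable (v₁ , v₂)

  Cancellative : Set c
  Cancellative =
    (∀ w u v → w · u ≡ w · v → u ≡ v) × (∀ w u v → u · w ≡ v · w → u ≡ v)

  Equidivisible : Set c
  Equidivisible =
    ∀ u₁ u₂ v₁ v₂ → u₁ · u₂ ≡ v₁ · v₂ →
      ∃[ w ] (((u₁ ≡ v₁ · w) × (v₂ ≡ w · u₂)) ⊎ ((v₁ ≡ u₁ · w) × (u₂ ≡ w · v₂)))

module Submission where

-- Minimality of a pair (w , u) says exactly that u cannot be
-- lowered while keeping w · u above w · u.  If w · u ≤ w · v, then
-- distributivity gives w · (u ∧ v) = w · u ∧ w · v ≥ w · u, so (w , u ∧ v)
-- is a smaller pair above w · u; minimality forces u ∧ v = u, i.e. u ≤ v.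
-- Hence multiplication reflects the order at the second component of a
-- minimal pair (and symmetrically at the first), and cancellativity follows
-- by antisymmetry, using only the minimality half of summability.
-- For equidivisibility, if u₁ · u₂ = v₁ · v₂ then the minimal pair (u₁ , u₂)
-- is minimal above v₁ · v₂, so the convexity property of (v₁ , v₂) supplies
-- a w with u₂ = w · v₂ or u₁ = v₁ · w; cancelling the common factor from
-- u₁ · u₂ = v₁ · v₂ yields the other equation of equidivisibility.

open import Level using (Level)
open import Data.Product using (_×_; _,_; proj₁; proj₂; ∃-syntax)
open import Data.Sum using (_⊎_; inj₁; inj₂)
open import Relation.Binary.PropositionalEquality using (_≡_; sym; cong; subst; module ≡-Reasoning)
open import Algebra.Structures using (IsMonoid)
open import Relation.Binary.Lattice.Structures using (IsMeetSemilattice)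
open import Defs

module _ {c ℓ : Level} (V : MeetSemilatticeMonoid c ℓ) where
  open MeetSemilatticeMonoid V
  open IsMonoid isMonoid using (assoc)
  open IsMeetSemilattice isMeetSemilattice
    using (antisym; reflexive; x∧y≤x; x∧y≤y; ∧-greatest) renaming (refl to ≤-refl)

  minimal-reflectsʳ : ∀ w u v → Minimal V (w , u) → w · u ≤ w · v → u ≤ v
  minimal-reflectsʳ w u v (_ , least) wu≤wv = subst (_≤ v) u∧v≡u (x∧y≤y u v)
    where
    lowered-above : w · u ≤ w · (u ∧ v)
    lowered-above = subst (w · u ≤_) (·-distribˡ-∧ w u v) (∧-greatest ≤-refl wu≤wv)

    u∧v≡u : u ∧ v ≡ u
    u∧v≡u = cong proj₂ (least (w , u ∧ v) (≤-refl , x∧y≤x u v) lowered-above)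

  minimal-reflectsˡ : ∀ w u v → Minimal V (u , w) → u · w ≤ v · w → u ≤ v
  minimal-reflectsˡ w u v (_ , least) uw≤vw = subst (_≤ v) u∧v≡u (x∧y≤y u v)
    where
    lowered-above : u · w ≤ (u ∧ v) · w
    lowered-above = subst (u · w ≤_) (·-distribʳ-∧ w u v) (∧-greatest ≤-refl uw≤vw)

    u∧v≡u : u ∧ v ≡ u
    u∧v≡u = cong proj₁ (least (u ∧ v , w) (x∧y≤x u v , ≤-refl) lowered-above)

  all-minimal⇒cancellative : (∀ v₁ v₂ → Minimal V (v₁ , v₂)) → Cancellative V
  all-minimal⇒cancellative minimal = cancelˡ , cancelʳ
    where
    cancelˡ : ∀ w u v → w · u ≡ w · v → u ≡ v
    cancelˡ w u v eq = antisym
      (minimal-reflectsʳ w u v (minimal w u) (reflexive eq))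
      (minimal-reflectsʳ w v u (minimal w v) (reflexive (sym eq)))

    cancelʳ : ∀ w u v → u · w ≡ v · w → u ≡ v
    cancelʳ w u v eq = antisym
      (minimal-reflectsˡ w u v (minimal u w) (reflexive eq))
      (minimal-reflectsˡ w v u (minimal v w) (reflexive (sym eq)))

  cancellative⇒common-refinement : Cancellative V → ∀ u₁ u₂ v₁ v₂ →
    Minimal V (u₁ , u₂) → ConvexityProperty V (v₁ , v₂) → u₁ · u₂ ≡ v₁ · v₂ →
    ∃[ w ] (((u₁ ≡ v₁ · w) × (v₂ ≡ w · u₂)) ⊎ ((v₁ ≡ u₁ · w) × (u₂ ≡ w · v₂)))
  cancellative⇒common-refinement (cancelˡ , cancelʳ) u₁ u₂ v₁ v₂ minimal convex eq
    with convex u₁ u₂ (subst (MinimalAbove V (u₁ , u₂)) eq minimal)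
  ... | inj₁ (w , _ , _ , u₂≡wv₂) = w , inj₂ (sym (cancelʳ v₂ (u₁ · w) v₁ u₁wv₂≡v₁v₂) , u₂≡wv₂)
    where
    open ≡-Reasoning
    u₁wv₂≡v₁v₂ : u₁ · w · v₂ ≡ v₁ · v₂
    u₁wv₂≡v₁v₂ = begin
      u₁ · w · v₂   ≡⟨ assoc u₁ w v₂ ⟩
      u₁ · (w · v₂) ≡⟨ cong (u₁ ·_) (sym u₂≡wv₂) ⟩
      u₁ · u₂       ≡⟨ eq ⟩
      v₁ · v₂       ∎
  ... | inj₂ (w , _ , _ , u₁≡v₁w) = w , inj₁ (u₁≡v₁w , cancelˡ v₁ v₂ (w · u₂) v₁v₂≡v₁wu₂)
    where
    open ≡-Reasoning
    v₁v₂≡v₁wu₂ : v₁ · v₂ ≡ v₁ · (w · u₂)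
    v₁v₂≡v₁wu₂ = begin
      v₁ · v₂       ≡⟨ sym eq ⟩
      u₁ · u₂       ≡⟨ cong (_· u₂) u₁≡v₁w ⟩
      v₁ · w · u₂   ≡⟨ assoc v₁ w u₂ ⟩
      v₁ · (w · u₂) ∎

lemma4 : {c ℓ : Level} (V : MeetSemilatticeMonoid c ℓ) →
    DecompositionProperty V → Cancellative V × Equidivisible V
lemma4 V summable = cancellative , equidivisible
  where
  cancellative : Cancellative V
  cancellative = all-minimal⇒cancellative V (λ v₁ v₂ → proj₁ (summable v₁ v₂))

  equidivisible : Equidivisible V
  equidivisible u₁ u₂ v₁ v₂ = cancellative⇒common-refinement V cancellative u₁ u₂ v₁ v₂
    (proj₁ (summable u₁ u₂)) (proj₂ (summable v₁ v₂))
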